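{- Let $t,m\in\mathbb{N}$ with $m\geq 3$. Let $G_0=K_{2,4t}$ with bipartition $\{x_1,x_2\}$, $\{y_1,\dots,y_{4t}\}$. Let $S_1=\{m-1,m\}$, $S_2=\{m+1,m+2\}$, let $A=\{\{s_1,s_2\}: s_1\in S_1,\ s_2\in S_2\}$, enumerated in any order as $A=\{A_0,A_1,A_2,A_3\}$, and let $L_0$ be the $m$-assignment for $G_0$ with $L_0(x_1)=[m-2]\cup S_1$, $L_0(x_2)=[m-2]\cup S_2$, and $L_0(y_k)=[m-2]\cup A_{\lfloor (k-1)/t\rfloor}$ for $k\in[4t]$. For each $c\in[3]$ let $G_c=K_{2,4t+c}$ with bipartition $\{x_1,x_2\}$, $\{y_1,\dots,y_{4t+c}\}$, and let $L_3$ be the $m$-assignment for $G_3$ given by $L_3(x_i)=L_0(x_i)$ for $i\in[2]$, $L_3(y_k)=L_0(y_k)$ for $k\in[4t]$, $L_3(y_{4t+1})=[m-2]\cup\{m-1,m+1\}$, $L_3(y_{4t+2})=[m-2]\cup\{m,m+2\}$, $L_3(y_{4t+3})=[m-2]\cup\{m-1,m+2\}$. For $c\in[2]$ let $L_c$ be the restriction of $L_3$ to $V(G_c)$. Then \begin{align*} P(G_0,L_0)&=(m-2)(m-1)^{4t}+(m-3)(m-2)^{4t+1}+4(m-2)^{2t+1}(m-1)^{2t}+4(m-2)^t(m-1)^{2t}m^t,\\ P(G_1,L_1)&=(m-2)(m-1)^{4t+1}+(m-3)(m-2)^{4t+2}+2(2m-3)(m-2)^{2t+1}(m-1)^{2t}+4(m-2)^t(m-1)^{2t+1}m^t,\\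 P(G_2,L_2)&=(m-2)(m-1)^{4t+2}+(m-3)(m-2)^{4t+3}+4(m-2)^{2t+2}(m-1)^{2t+1}+2(2m^2-4m+1)(m-2)^t(m-1)^{2t}m^t,\\ P(G_3,L_3)&=(m-2)(m-1)^{4t+3}+(m-3)(m-2)^{4t+4}+2(2m-3)(m-2)^{2t+2}(m-1)^{2t+1}+2(2m^2-4m+1)(m-2)^t(m-1)^{2t+1}m^t. \end{align*}
   Context: For a list assignment $L$ of a graph $G$ (each vertex $v$ gets a set $L(v)$ of colors; an $m$-assignment if all $|L(v)|=m$), $P(G,L)$ is the number of proper colorings $f$ of $G$ with $f(v)\in L(v)$ for all $v$. $[k]=\{1,\dots,k\}$ (and $[0]=\emptyset$). -}

module Defs where

open import Data.Nat using (ℕ; zero; suc; _+_; _*_; _∸_; _<_; _≤_; _<?_; _≤?_)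
open import Data.Nat.DivMod using (_/_)
open import Data.Fin using (Fin; toℕ) renaming (zero to fzero; suc to fsuc)
open import Data.Fin.Properties using (all?)
open import Data.Fin.Permutation using (Permutation′; _⟨$⟩ʳ_)
open import Data.List using (List; []; _∷_; [_]; _++_; map; concatMap; filter; length; applyUpTo)
open import Data.Vec using (Vec; lookup) renaming ([] to []ᵥ; _∷_ to _∷ᵥ_)
open import Data.Product using (_×_)
open import Data.Sum using (_⊎_)
open import Relation.Nullary using (¬_; Dec; yes; no)
open import Relation.Nullary.Decidable using (_×-dec_; _⊎-dec_; ¬?; _→-dec_)
open import Relation.Binary using (Decidable)
open import Relation.Binary.PropositionalEquality using (_≡_; _≢_)
import Data.Nat.Properties as ℕP

record Graph : Set₁ where
  field
    n    : ℕ
    Adj  : Fin n → Fin n → Set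
    adj? : Decidable Adj

-- A list assignment: each vertex gets a finite set of colours (natural
-- numbers), represented by a duplicate-free list.
ListAssignment : Graph → Set
ListAssignment G = Fin (Graph.n G) → List ℕ

choices : (n : ℕ) → (Fin n → List ℕ) → List (Vec ℕ n)
choices zero    L = [ []ᵥ ]
choices (suc n) L =
  concatMap (λ c → map (c ∷ᵥ_) (choices n (λ i → L (fsuc i)))) (L fzero)

Proper : (G : Graph) → Vec ℕ (Graph.n G) → Set
Proper G f = ∀ i j → Graph.Adj G i j → lookup f i ≢ lookup f j

proper? : (G : Graph) → (f : Vec ℕ (Graph.n G)) → Dec (Proper G f)
proper? G f = all? (λ i → all? (λ j →
  Graph.adj? G i j →-dec ¬? (lookup f i ℕP.≟ lookup f j)))

P : (G : Graph) → ListAssignment G → ℕ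
P G L = length (filter (proper? G) (choices (Graph.n G) L))

-- Complete bipartite graph K_{2,n}: vertex set Fin (2 + n), where
-- vertex 0 = x₁, vertex 1 = x₂, vertex 1 + k = y_k  (k ∈ [n]).

IsX : ℕ → Set
IsX v = v < 2

K2 : ℕ → Graph
K2 n = record
  { n    = 2 + n
  ; Adj  = λ i j → (IsX (toℕ i) × ¬ IsX (toℕ j)) ⊎ (¬ IsX (toℕ i) × IsX (toℕ j))
  ; adj? = λ i j → ((toℕ i <? 2) ×-dec ¬? (toℕ j <? 2))
                   ⊎-dec (¬? (toℕ i <? 2) ×-dec (toℕ j <? 2))
  }

range : ℕ → List ℕ
range k = applyUpTo suc k

Aref : ℕ → Fin 4 → List ℕ
Aref m fzero                      = (m ∸ 1) ∷ (m + 1) ∷ []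
Aref m (fsuc fzero)               = (m ∸ 1) ∷ (m + 2) ∷ []
Aref m (fsuc (fsuc fzero))        = m ∷ (m + 1) ∷ []
Aref m (fsuc (fsuc (fsuc fzero))) = m ∷ (m + 2) ∷ []

-- the enumeration A₀,…,A₃ of A, given by an arbitrary permutation σ
Aenum : ℕ → Permutation′ 4 → Fin 4 → List ℕ
Aenum m σ i = Aref m (σ ⟨$⟩ʳ i)

-- ⌊ a / t ⌋ (for t = 0 there are no y-vertices in G₀, the value is irrelevant)
divT : ℕ → ℕ → ℕ
divT a zero    = 0
divT a (suc t) = a / suc t

-- ℕ → Fin 4; only used on values ⌊(k-1)/t⌋ ≤ 3 where it is the identity
toFin4 : ℕ → Fin 4
toFin4 0 = fzero
toFin4 1 = fsuc fzero
toFin4 2 = fsuc (fsuc fzero)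
toFin4 _ = fsuc (fsuc (fsuc fzero))

L0fun : (m t : ℕ) → Permutation′ 4 → ℕ → List ℕ
L0fun m t σ 0       = range (m ∸ 2) ++ ((m ∸ 1) ∷ m ∷ [])
L0fun m t σ 1       = range (m ∸ 2) ++ ((m + 1) ∷ (m + 2) ∷ [])
L0fun m t σ (suc (suc j)) =   -- j = k - 1
  range (m ∸ 2) ++ Aenum m σ (toFin4 (divT j t))

L0 : (m t : ℕ) → Permutation′ 4 → ListAssignment (K2 (4 * t))
L0 m t σ v = L0fun m t σ (toℕ v)

L3fun : (m t : ℕ) → Permutation′ 4 → ℕ → List ℕ
L3fun m t σ v with v <? 2 + 4 * t
... | yes _ = L0fun m t σ v
... | no  _ with v ∸ (2 + 4 * t)
...   | 0 = range (m ∸ 2) ++ ((m ∸ 1) ∷ (m + 1) ∷ [])   -- y_{4t+1}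
...   | 1 = range (m ∸ 2) ++ (m ∷ (m + 2) ∷ [])         -- y_{4t+2}
...   | _ = range (m ∸ 2) ++ ((m ∸ 1) ∷ (m + 2) ∷ [])   -- y_{4t+3}

Lc : (m t : ℕ) → Permutation′ 4 → (c : ℕ) → ListAssignment (K2 (4 * t + c))
Lc m t σ c v = L3fun m t σ (toℕ v)

-- Colour x₁ and x₂ first: a proper colouring of K_{2,n} then extends independently to
-- every y, which only has to avoid the two colours used on x₁ and x₂, so
--   P(G, L) = Σ_{c₁ ∈ L(x₁)} Σ_{c₂ ∈ L(x₂)} Π_y |L(y) ∖ {c₁, c₂}|.
-- Every list is [m-2] ∪ {s₁, s₂} with s₁ ∈ S₁ = L(x₁) ∖ [m-2] and s₂ ∈ S₂ = L(x₂) ∖ [m-2],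
-- so |L(y) ∖ {c₁, c₂}| is m-2, m-1 or m, depending only on how c₁ and c₂ meet [m-2]
-- (and whether they coincide) and on whether c₁ = s₁, c₂ = s₂.  This splits the pairs
-- (c₁, c₂) into ten classes on each of which the product is a fixed monomial in
-- (m-2)^t, (m-1)^t and m^t; the y_k with k ≤ 4t contribute a t-th power for each
-- type A_i, whatever the enumeration of A.
module Submission where

open import Defs
open import Data.Nat using (ℕ; zero; suc; _+_; _*_; _∸_; _^_; _≤_; _<_; z≤n; s≤s; _<?_)
open import Data.Nat.Properties
open import Data.Nat.DivMod using (_/_; n/n≡1; m<n⇒m/n≡0; +-distrib-/-∣ˡ)
open import Data.Nat.Divisibility using (∣-refl)
open import Data.Nat.ListAction using (sum)
open import Data.Nat.ListAction.Properties using (sum-++)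
open import Data.Nat.Tactic.RingSolver using (solve-∀)
open import Data.Fin using (Fin; toℕ) renaming (suc to fsuc)
open import Data.Fin.Patterns using (0F; 1F; 2F; 3F)
open import Data.Fin.Permutation using (Permutation′)
open import Data.List using (List; []; _∷_; [_]; _++_; map; concatMap; filter; length)
open import Data.List.Properties
  using ( filter-++; length-++; filter-accept; filter-reject; filter-≐; filter-none
        ; map-cong; map-++; applyUpTo-∷ʳ )
import Data.List.Relation.Unary.All as ListAll
open import Algebra.Properties.CommutativeMonoid.Sum *-1-commutativeMonoid
  using () renaming (sum to ∏; sum-permute to ∏-permute; sum-cong-≗ to ∏-cong)
open import Data.Vec using (Vec; lookup) renaming (_∷_ to _∷ᵥ_)
open import Data.Vec.Relation.Unary.All using (All; _∷_; all?)
open import Data.Vec.Relation.Unary.All.Properties using (lookup⁺; lookup⁻)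
open import Data.Product using (_×_; _,_; proj₁; proj₂)
open import Data.Sum using (_⊎_; inj₁; inj₂; [_,_]′; map₂)
open import Data.Bool using (true; false)
open import Data.Empty using (⊥-elim)
open import Function using (_∘_)
open import Relation.Nullary using (¬_; yes; no; does)
open import Relation.Nullary.Decidable using (_×-dec_; ¬?)
open import Relation.Unary using (Pred; Decidable)
open import Relation.Binary.PropositionalEquality
  using (_≡_; _≢_; refl; sym; trans; cong; cong₂; ≢-sym; module ≡-Reasoning)

private variable
  A B : Set

∏< : ℕ → (ℕ → ℕ) → ℕ
∏< zero    f = 1
∏< (suc n) f = f 0 * ∏< n (f ∘ suc)

infix 5 ∏<
syntax ∏< n (λ j → e) = ∏[ j < n ] e

∏<-+ : ∀ m n f → ∏< (m + n) f ≡ ∏< m f * ∏< n (λ j → f (m + j))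
∏<-+ zero    n f = sym (+-identityʳ _)
∏<-+ (suc m) n f = trans (cong (f 0 *_) (∏<-+ m n (f ∘ suc))) (sym (*-assoc (f 0) _ _))

∏<-cong : ∀ n {f g} → (∀ j → j < n → f j ≡ g j) → ∏< n f ≡ ∏< n g
∏<-cong zero    eq = refl
∏<-cong (suc n) eq = cong₂ _*_ (eq 0 (s≤s z≤n)) (∏<-cong n (λ j j<n → eq (suc j) (s≤s j<n)))

∏<-const : ∀ n c → ∏[ j < n ] c ≡ c ^ n
∏<-const zero    c = refl
∏<-const (suc n) c = cong (c *_) (∏<-const n c)

divT-+ : ∀ t j → divT (suc t + j) (suc t) ≡ suc (divT j (suc t))
divT-+ t j = trans (+-distrib-/-∣ˡ j (∣-refl {suc t})) (cong (_+ j / suc t) (n/n≡1 (suc t)))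

∏<-blocks : ∀ n t (h : ℕ → ℕ) → ∏[ j < n * t ] h (divT j t) ≡ ∏[ i < n ] h i ^ t
∏<-blocks n zero h =
  trans (cong (λ l → ∏[ j < l ] h (divT j 0)) (*-zeroʳ n)) (sym (trans (∏<-const n 1) (^-zeroˡ n)))
∏<-blocks zero (suc t) h = refl
∏<-blocks (suc n) (suc t) h = begin
  ∏[ j < suc t + n * suc t ] h (divT j (suc t))
    ≡⟨ ∏<-+ (suc t) (n * suc t) (λ j → h (divT j (suc t))) ⟩
  (∏[ j < suc t ] h (divT j (suc t))) * (∏[ j < n * suc t ] h (divT (suc t + j) (suc t)))
    ≡⟨ cong₂ _*_ first-block (∏<-cong (n * suc t) (λ j _ → cong h (divT-+ t j))) ⟩
  h 0 ^ suc t * (∏[ j < n * suc t ] h (suc (divT j (suc t))))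
    ≡⟨ cong (h 0 ^ suc t *_) (∏<-blocks n (suc t) (h ∘ suc)) ⟩
  h 0 ^ suc t * (∏[ i < n ] h (suc i) ^ suc t) ∎
  where
  open ≡-Reasoning
  first-block : ∏[ j < suc t ] h (divT j (suc t)) ≡ h 0 ^ suc t
  first-block = trans (∏<-cong (suc t) (λ j j<t → cong h (m<n⇒m/n≡0 j<t))) (∏<-const (suc t) (h 0))

module _ {p} {P : Pred A p} (P? : Decidable P) where

  length-filter-++ : ∀ xs ys →
    length (filter P? (xs ++ ys)) ≡ length (filter P? xs) + length (filter P? ys)
  length-filter-++ xs ys = trans (cong length (filter-++ P? xs ys)) (length-++ (filter P? xs))

  length-filter-concatMap : (f : B → List A) → ∀ xs →
    length (filter P? (concatMap f xs)) ≡ sum (map (λ x → length (filter P? (f x))) xs)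
  length-filter-concatMap f []       = refl
  length-filter-concatMap f (x ∷ xs) =
    trans (length-filter-++ (f x) (concatMap f xs))
          (cong (length (filter P? (f x)) +_) (length-filter-concatMap f xs))

  length-filter-map : (f : B → A) → ∀ xs →
    length (filter P? (map f xs)) ≡ length (filter (P? ∘ f) xs)
  length-filter-map f []       = refl
  length-filter-map f (x ∷ xs) with does (P? (f x))
  ... | true  = cong suc (length-filter-map f xs)
  ... | false = length-filter-map f xs

module _ {p} {P : Pred ℕ p} (P? : Decidable P) where

  count-choices-cons : ∀ {n} (vs : List (Vec ℕ n)) xs →
    sum (map (λ c → length (filter (all? P?) (map (c ∷ᵥ_) vs))) xs)
      ≡ length (filter P? xs) * length (filter (all? P?) vs)
  count-choices-cons vs []       = refl
  count-choices-cons vs (x ∷ xs) with P? x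
  ... | yes px = cong₂ _+_ kept (count-choices-cons vs xs)
    where
    kept : length (filter (all? P?) (map (x ∷ᵥ_) vs)) ≡ length (filter (all? P?) vs)
    kept = trans (length-filter-map (all? P?) (x ∷ᵥ_) vs)
                 (cong length (filter-≐ _ (all? P?) ((λ { (_ ∷ pvs) → pvs }) , (px ∷_)) vs))
  ... | no ¬px = cong₂ _+_ dropped (count-choices-cons vs xs)
    where
    dropped : length (filter (all? P?) (map (x ∷ᵥ_) vs)) ≡ 0
    dropped = trans (length-filter-map (all? P?) (x ∷ᵥ_) vs)
                    (cong length (filter-none _ (ListAll.universal (λ { _ (px ∷ _) → ¬px px }) vs)))

  count-choices : ∀ n (G : ℕ → List ℕ) →
    length (filter (all? P?) (choices n (G ∘ toℕ))) ≡ ∏[ j < n ] length (filter P? (G j))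
  count-choices zero    G = refl
  count-choices (suc n) G =
    trans (length-filter-concatMap (all? P?) (λ c → map (c ∷ᵥ_) vs) (G 0))
    (trans (count-choices-cons vs (G 0))
           (cong (length (filter P? (G 0)) *_) (count-choices n (G ∘ suc))))
    where
    vs : List (Vec ℕ n)
    vs = choices n (G ∘ suc ∘ toℕ)

Avoids : ℕ → ℕ → ℕ → Set
Avoids c₁ c₂ y = y ≢ c₁ × y ≢ c₂

avoids? : ∀ c₁ c₂ → Decidable (Avoids c₁ c₂)
avoids? c₁ c₂ y = ¬? (y ≟ c₁) ×-dec ¬? (y ≟ c₂)

avoid : ℕ → ℕ → List ℕ → ℕ
avoid c₁ c₂ xs = length (filter (avoids? c₁ c₂) xs)

module _ {n} {c₁ c₂ : ℕ} {ys : Vec ℕ n} where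

  private
    f : Vec ℕ (2 + n)
    f = c₁ ∷ᵥ c₂ ∷ᵥ ys

  x-colour : ∀ i → IsX (toℕ i) → lookup f i ≡ c₁ ⊎ lookup f i ≡ c₂
  x-colour 0F               _ = inj₁ refl
  x-colour 1F               _ = inj₂ refl
  x-colour (fsuc (fsuc _)) (s≤s (s≤s ()))

  y-colour : All (Avoids c₁ c₂) ys → ∀ i → ¬ IsX (toℕ i) → Avoids c₁ c₂ (lookup f i)
  y-colour _  0F              ¬x = ⊥-elim (¬x (s≤s z≤n))
  y-colour _  1F              ¬x = ⊥-elim (¬x (s≤s (s≤s z≤n)))
  y-colour av (fsuc (fsuc j)) _  = lookup⁺ av j

  avoids⇒proper : All (Avoids c₁ c₂) ys → Proper (K2 n) f
  avoids⇒proper av i j (inj₁ (xi , ¬xj)) = clash (x-colour i xi) (y-colour av j ¬xj)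
    where
    clash : ∀ {x y} → x ≡ c₁ ⊎ x ≡ c₂ → Avoids c₁ c₂ y → x ≢ y
    clash (inj₁ refl) (y≢c₁ , _) x≡y = y≢c₁ (sym x≡y)
    clash (inj₂ refl) (_ , y≢c₂) x≡y = y≢c₂ (sym x≡y)
  avoids⇒proper av i j (inj₂ (¬xi , xj)) = avoids⇒proper av j i (inj₁ (xj , ¬xi)) ∘ sym

  proper⇒avoids : Proper (K2 n) f → All (Avoids c₁ c₂) ys
  proper⇒avoids pr = lookup⁻ λ j →
      (λ e → pr 0F (fsuc (fsuc j)) (inj₁ (s≤s z≤n       , y-not-x)) (sym e))
    , (λ e → pr 1F (fsuc (fsuc j)) (inj₁ (s≤s (s≤s z≤n) , y-not-x)) (sym e))
    where
    y-not-x : ∀ {v} → ¬ IsX (suc (suc v))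
    y-not-x (s≤s (s≤s ()))

P-K2 : ∀ n (F : ℕ → List ℕ) →
  P (K2 n) (F ∘ toℕ)
    ≡ sum (map (λ c₁ → sum (map (λ c₂ → ∏[ j < n ] avoid c₁ c₂ (F (2 + j))) (F 1))) (F 0))
P-K2 n F =
  trans (length-filter-concatMap proper?₂ (λ c₁ → map (c₁ ∷ᵥ_) zs) (F 0))
        (cong sum (map-cong per-c₁ (F 0)))
  where
  ys : List (Vec ℕ n)
  ys = choices n (F ∘ suc ∘ suc ∘ toℕ)
  zs : List (Vec ℕ (1 + n))
  zs = concatMap (λ c₂ → map (c₂ ∷ᵥ_) ys) (F 1)
  proper?₂ : Decidable (Proper (K2 n))
  proper?₂ = proper? (K2 n)
  per-c₂ : ∀ c₁ c₂ → length (filter (proper?₂ ∘ (c₁ ∷ᵥ_)) (map (c₂ ∷ᵥ_) ys))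
                      ≡ ∏[ j < n ] avoid c₁ c₂ (F (2 + j))
  per-c₂ c₁ c₂ =
    trans (length-filter-map (proper?₂ ∘ (c₁ ∷ᵥ_)) (c₂ ∷ᵥ_) ys)
    (trans (cong length (filter-≐ _ (all? (avoids? c₁ c₂)) (proper⇒avoids , avoids⇒proper) ys))
           (count-choices (avoids? c₁ c₂) n (F ∘ suc ∘ suc)))
  per-c₁ : ∀ c₁ → length (filter proper?₂ (map (c₁ ∷ᵥ_) zs))
                   ≡ sum (map (λ c₂ → ∏[ j < n ] avoid c₁ c₂ (F (2 + j))) (F 1))
  per-c₁ c₁ =
    trans (length-filter-map proper?₂ (c₁ ∷ᵥ_) zs)
    (trans (length-filter-concatMap (proper?₂ ∘ (c₁ ∷ᵥ_)) (λ c₂ → map (c₂ ∷ᵥ_) ys) (F 1))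
           (cong sum (map-cong (per-c₂ c₁) (F 1))))

module _ {c₁ c₂ : ℕ} where

  avoid-++ : ∀ xs ys → avoid c₁ c₂ (xs ++ ys) ≡ avoid c₁ c₂ xs + avoid c₁ c₂ ys
  avoid-++ = length-filter-++ (avoids? c₁ c₂)

  avoid-sym : ∀ xs → avoid c₁ c₂ xs ≡ avoid c₂ c₁ xs
  avoid-sym xs = cong length (filter-≐ _ _ (swap , swap) xs)
    where
    swap : ∀ {x y z : ℕ} → x ≢ y × x ≢ z → x ≢ z × x ≢ y
    swap (p , q) = q , p

  avoid-[]-hit : ∀ {x} → x ≡ c₁ ⊎ x ≡ c₂ → avoid c₁ c₂ [ x ] ≡ 0
  avoid-[]-hit hit =
    cong length (filter-reject (avoids? c₁ c₂) λ { (x≢c₁ , x≢c₂) → [ x≢c₁ , x≢c₂ ]′ hit })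

  avoid-[]-miss : ∀ {x} → x ≢ c₁ → x ≢ c₂ → avoid c₁ c₂ [ x ] ≡ 1
  avoid-[]-miss x≢c₁ x≢c₂ = cong length (filter-accept (avoids? c₁ c₂) (x≢c₁ , x≢c₂))

  avoid-range-suc : ∀ n →
    avoid c₁ c₂ (range (suc n)) ≡ avoid c₁ c₂ (range n) + avoid c₁ c₂ [ suc n ]
  avoid-range-suc n =
    trans (cong (avoid c₁ c₂) (sym (applyUpTo-∷ʳ suc n))) (avoid-++ (range n) [ suc n ])

≤-suc-≢ : ∀ {c n} → c ≤ suc n → c ≢ suc n → c ≤ n
≤-suc-≢ c≤1+n c≢1+n = ≤-pred (≤∧≢⇒< c≤1+n c≢1+n)

avoid-range-none : ∀ n {c₁ c₂} → n < c₁ → n < c₂ → avoid c₁ c₂ (range n) ≡ n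
avoid-range-none zero    _     _     = refl
avoid-range-none (suc n) {c₁} {c₂} n<c₁ n<c₂ = begin
  avoid c₁ c₂ (range (suc n))
    ≡⟨ avoid-range-suc n ⟩
  avoid c₁ c₂ (range n) + avoid c₁ c₂ [ suc n ]
    ≡⟨ cong₂ _+_ (avoid-range-none n (below n<c₁) (below n<c₂))
                 (avoid-[]-miss (<⇒≢ n<c₁) (<⇒≢ n<c₂)) ⟩
  n + 1
    ≡⟨ +-comm n 1 ⟩
  suc n ∎
  where
  open ≡-Reasoning
  below : ∀ {c} → suc n < c → n < c
  below = <-trans (n<1+n n)

avoid-range-one : ∀ n {c c′} → 0 < c → c ≤ n → c′ ≡ c ⊎ n < c′ → suc (avoid c c′ (range n)) ≡ n
avoid-range-one zero 0<c c≤0 _ = ⊥-elim (<⇒≱ 0<c c≤0)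
avoid-range-one (suc n) {c} {c′} 0<c c≤1+n c′-out with c ≟ suc n
... | yes refl = cong suc (begin
  avoid c c′ (range (suc n))
    ≡⟨ avoid-range-suc n ⟩
  avoid c c′ (range n) + avoid c c′ [ suc n ]
    ≡⟨ cong₂ _+_ (avoid-range-none n (n<1+n n) n<c′) (avoid-[]-hit {c} {c′} {suc n} (inj₁ refl)) ⟩
  n + 0
    ≡⟨ +-identityʳ n ⟩
  n ∎)
  where
  open ≡-Reasoning
  n<c′ : n < c′
  n<c′ = [ (λ { refl → n<1+n n }) , <-trans (n<1+n n) ]′ c′-out
... | no c≢1+n = cong suc (begin
  avoid c c′ (range (suc n))
    ≡⟨ avoid-range-suc n ⟩
  avoid c c′ (range n) + avoid c c′ [ suc n ]
    ≡⟨ cong (avoid c c′ (range n) +_) (avoid-[]-miss (≢-sym c≢1+n) 1+n≢c′) ⟩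
  avoid c c′ (range n) + 1
    ≡⟨ +-comm _ 1 ⟩
  suc (avoid c c′ (range n))
    ≡⟨ avoid-range-one n 0<c (≤-suc-≢ c≤1+n c≢1+n) (map₂ (<-trans (n<1+n n)) c′-out) ⟩
  n ∎)
  where
  open ≡-Reasoning
  1+n≢c′ : suc n ≢ c′
  1+n≢c′ = [ (λ { refl → ≢-sym c≢1+n }) , <⇒≢ ]′ c′-out

avoid-range-two : ∀ n {c₁ c₂} → 0 < c₁ → c₁ ≤ n → 0 < c₂ → c₂ ≤ n → c₁ ≢ c₂ →
                  2 + avoid c₁ c₂ (range n) ≡ n
avoid-range-two zero 0<c₁ c₁≤0 _ _ _ = ⊥-elim (<⇒≱ 0<c₁ c₁≤0)
avoid-range-two (suc n) {c₁} {c₂} 0<c₁ c₁≤1+n 0<c₂ c₂≤1+n c₁≢c₂ with c₁ ≟ suc n | c₂ ≟ suc n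
... | yes refl | _ = begin
  2 + avoid c₁ c₂ (range (suc n))
    ≡⟨ cong (2 +_) (avoid-range-suc n) ⟩
  2 + (avoid c₁ c₂ (range n) + avoid c₁ c₂ [ suc n ])
    ≡⟨ cong (λ z → 2 + (avoid c₁ c₂ (range n) + z)) (avoid-[]-hit {c₁} {c₂} {suc n} (inj₁ refl)) ⟩
  2 + (avoid c₁ c₂ (range n) + 0)
    ≡⟨ cong (2 +_) (trans (+-identityʳ _) (avoid-sym (range n))) ⟩
  2 + avoid c₂ c₁ (range n)
    ≡⟨ cong suc (avoid-range-one n 0<c₂ (≤-suc-≢ c₂≤1+n (≢-sym c₁≢c₂)) (inj₂ (n<1+n n))) ⟩
  suc n ∎
  where open ≡-Reasoning
... | no c₁≢1+n | yes refl = begin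
  2 + avoid c₁ c₂ (range (suc n))
    ≡⟨ cong (2 +_) (avoid-range-suc n) ⟩
  2 + (avoid c₁ c₂ (range n) + avoid c₁ c₂ [ suc n ])
    ≡⟨ cong (λ z → 2 + (avoid c₁ c₂ (range n) + z)) (avoid-[]-hit {c₁} {c₂} {suc n} (inj₂ refl)) ⟩
  2 + (avoid c₁ c₂ (range n) + 0)
    ≡⟨ cong (2 +_) (+-identityʳ _) ⟩
  2 + avoid c₁ c₂ (range n)
    ≡⟨ cong suc (avoid-range-one n 0<c₁ (≤-suc-≢ c₁≤1+n c₁≢1+n) (inj₂ (n<1+n n))) ⟩
  suc n ∎
  where open ≡-Reasoning
... | no c₁≢1+n | no c₂≢1+n = begin
  2 + avoid c₁ c₂ (range (suc n))
    ≡⟨ cong (2 +_) (avoid-range-suc n) ⟩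
  2 + (avoid c₁ c₂ (range n) + avoid c₁ c₂ [ suc n ])
    ≡⟨ cong (λ z → 2 + (avoid c₁ c₂ (range n) + z)) (avoid-[]-miss (≢-sym c₁≢1+n) (≢-sym c₂≢1+n)) ⟩
  2 + (avoid c₁ c₂ (range n) + 1)
    ≡⟨ cong (2 +_) (+-comm _ 1) ⟩
  suc (2 + avoid c₁ c₂ (range n))
    ≡⟨ cong suc (avoid-range-two n 0<c₁ (≤-suc-≢ c₁≤1+n c₁≢1+n)
                                   0<c₂ (≤-suc-≢ c₂≤1+n c₂≢1+n) c₁≢c₂) ⟩
  suc n ∎
  where open ≡-Reasoning

sum-range-suc : ∀ n (f : ℕ → ℕ) → sum (map f (range (suc n))) ≡ sum (map f (range n)) + f (suc n)
sum-range-suc n f = begin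
  sum (map f (range (suc n)))              ≡⟨ cong (sum ∘ map f) (sym (applyUpTo-∷ʳ suc n)) ⟩
  sum (map f (range n ++ [ suc n ]))       ≡⟨ cong sum (map-++ f (range n) [ suc n ]) ⟩
  sum (map f (range n) ++ [ f (suc n) ])   ≡⟨ sum-++ (map f (range n)) [ f (suc n) ] ⟩
  sum (map f (range n)) + (f (suc n) + 0)  ≡⟨ cong (sum (map f (range n)) +_) (+-identityʳ _) ⟩
  sum (map f (range n)) + f (suc n)        ∎
  where open ≡-Reasoning

sum-++-pair : ∀ (f : ℕ → ℕ) xs u v →
              sum (map f (xs ++ u ∷ v ∷ [])) ≡ sum (map f xs) + (f u + (f v + 0))
sum-++-pair f xs u v = trans (cong sum (map-++ f xs (u ∷ v ∷ []))) (sum-++ (map f xs) _)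

sum-range-const : ∀ n {f : ℕ → ℕ} {y} → (∀ c → 0 < c → c ≤ n → f c ≡ y) →
                  sum (map f (range n)) ≡ n * y
sum-range-const zero    _  = refl
sum-range-const (suc n) {f} {y} fy = begin
  sum (map f (range (suc n)))
    ≡⟨ sum-range-suc n f ⟩
  sum (map f (range n)) + f (suc n)
    ≡⟨ cong₂ _+_ (sum-range-const n (λ c 0<c c≤n → fy c 0<c (m≤n⇒m≤1+n c≤n)))
                 (fy (suc n) (s≤s z≤n) ≤-refl) ⟩
  n * y + y
    ≡⟨ +-comm (n * y) y ⟩
  suc n * y ∎
  where open ≡-Reasoning

sum-range-point : ∀ n {f : ℕ → ℕ} {c x y} → 0 < c → c ≤ suc n → f c ≡ x →
                  (∀ c′ → 0 < c′ → c′ ≤ suc n → c′ ≢ c → f c′ ≡ y) →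
                  sum (map f (range (suc n))) ≡ x + n * y
sum-range-point zero (s≤s z≤n) (s≤s z≤n) fc _ = cong (_+ 0) fc
sum-range-point (suc n) {f} {c} {x} {y} 0<c c≤2+n fc fy with c ≟ suc (suc n)
... | yes refl = begin
  sum (map f (range (suc (suc n))))
    ≡⟨ sum-range-suc (suc n) f ⟩
  sum (map f (range (suc n))) + f (suc (suc n))
    ≡⟨ cong (_+ f (suc (suc n))) (sum-range-const (suc n) λ c′ 0<c′ c′≤1+n →
         fy c′ 0<c′ (m≤n⇒m≤1+n c′≤1+n) (<⇒≢ (s≤s c′≤1+n))) ⟩
  suc n * y + f (suc (suc n))
    ≡⟨ cong (suc n * y +_) fc ⟩
  suc n * y + x
    ≡⟨ +-comm (suc n * y) x ⟩
  x + suc n * y ∎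
  where open ≡-Reasoning
... | no c≢2+n = begin
  sum (map f (range (suc (suc n))))
    ≡⟨ sum-range-suc (suc n) f ⟩
  sum (map f (range (suc n))) + f (suc (suc n))
    ≡⟨ cong₂ _+_ (sum-range-point n 0<c (≤-suc-≢ c≤2+n c≢2+n) fc λ c′ 0<c′ c′≤1+n →
                    fy c′ 0<c′ (m≤n⇒m≤1+n c′≤1+n))
                 (fy (suc (suc n)) (s≤s z≤n) ≤-refl (≢-sym c≢2+n)) ⟩
  x + n * y + y
    ≡⟨ rearrange x y n ⟩
  x + suc n * y ∎
  where
  open ≡-Reasoning
  rearrange : ∀ x y n → x + n * y + y ≡ x + (y + n * y)
  rearrange = solve-∀

⟨_,_,_,_⟩ : ℕ → ℕ → ℕ → ℕ → Fin 4 → ℕ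
⟨ x₀ , x₁ , x₂ , x₃ ⟩ 0F = x₀
⟨ x₀ , x₁ , x₂ , x₃ ⟩ 1F = x₁
⟨ x₀ , x₁ , x₂ , x₃ ⟩ 2F = x₂
⟨ x₀ , x₁ , x₂ , x₃ ⟩ 3F = x₃

⟨⟩-η : ∀ (g : Fin 4 → ℕ) i → g i ≡ ⟨ g 0F , g 1F , g 2F , g 3F ⟩ i
⟨⟩-η g 0F = refl
⟨⟩-η g 1F = refl
⟨⟩-η g 2F = refl
⟨⟩-η g 3F = refl

-- y_{4t+1}, y_{4t+2}, y_{4t+3} carry the lists of the types Aref 0, Aref 3, Aref 1.
extraType : ℕ → Fin 4
extraType 0 = 0F
extraType 1 = 3F
extraType _ = 1F

module _ (m t : ℕ) (σ : Permutation′ 4) where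

  L3fun-below : ∀ j → j < 4 * t → L3fun m t σ (2 + j) ≡ L0fun m t σ (2 + j)
  L3fun-below j j<4t with 2 + j <? 2 + 4 * t
  ... | yes _  = refl
  ... | no  ¬< = ⊥-elim (¬< (s≤s (s≤s j<4t)))

  L3fun-above : ∀ v → ¬ v < 2 + 4 * t →
                L3fun m t σ v ≡ range (m ∸ 2) ++ Aref m (extraType (v ∸ (2 + 4 * t)))
  L3fun-above v ¬< with v <? 2 + 4 * t
  ... | yes < = ⊥-elim (¬< <)
  ... | no  _ with v ∸ (2 + 4 * t)
  ...   | 0           = refl
  ...   | 1           = refl
  ...   | suc (suc _) = refl

  L3fun-extra : ∀ e → L3fun m t σ (2 + (4 * t + e)) ≡ range (m ∸ 2) ++ Aref m (extraType e)
  L3fun-extra e =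
    trans (L3fun-above (2 + (4 * t + e)) (≤⇒≯ (s≤s (s≤s (m≤m+n (4 * t) e)))))
          (cong (λ z → range (m ∸ 2) ++ Aref m (extraType z)) (m+n∸m≡n (2 + 4 * t) e))

module Colourings (k t : ℕ) (σ : Permutation′ 4) where

  m a b q₁ q₂ : ℕ
  m  = 3 + k
  a  = m ∸ 2
  b  = m ∸ 1
  q₁ = m + 1
  q₂ = m + 2

  profile : ℕ → ℕ → Fin 4 → ℕ
  profile c₁ c₂ i = avoid c₁ c₂ (range a ++ Aref m i)

  S₁ S₂ : Fin 4 → ℕ
  S₁ = ⟨ b  , b  , m  , m  ⟩
  S₂ = ⟨ q₁ , q₂ , q₁ , q₂ ⟩

  Aref≡S₁S₂ : ∀ i → Aref m i ≡ [ S₁ i ] ++ [ S₂ i ]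
  Aref≡S₁S₂ 0F = refl
  Aref≡S₁S₂ 1F = refl
  Aref≡S₁S₂ 2F = refl
  Aref≡S₁S₂ 3F = refl

  profile-≗ : ∀ {c₁ c₂ α} {r s : Fin 4 → ℕ} →
              (∀ i → avoid c₁ c₂ [ S₁ i ] ≡ r i) → (∀ i → avoid c₁ c₂ [ S₂ i ] ≡ s i) →
              avoid c₁ c₂ (range a) ≡ α →
              ∀ i → profile c₁ c₂ i ≡ ⟨ r 0F + s 0F + α , r 1F + s 1F + α
                                      , r 2F + s 2F + α , r 3F + s 3F + α ⟩ i
  profile-≗ {c₁} {c₂} {α} {r} {s} row col avoid-α i = begin
    avoid c₁ c₂ (range a ++ Aref m i)
      ≡⟨ avoid-++ (range a) (Aref m i) ⟩
    avoid c₁ c₂ (range a) + avoid c₁ c₂ (Aref m i)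
      ≡⟨ cong (λ l → avoid c₁ c₂ (range a) + avoid c₁ c₂ l) (Aref≡S₁S₂ i) ⟩
    avoid c₁ c₂ (range a) + avoid c₁ c₂ ([ S₁ i ] ++ [ S₂ i ])
      ≡⟨ cong (avoid c₁ c₂ (range a) +_) (avoid-++ [ S₁ i ] [ S₂ i ]) ⟩
    avoid c₁ c₂ (range a) + (avoid c₁ c₂ [ S₁ i ] + avoid c₁ c₂ [ S₂ i ])
      ≡⟨ +-comm (avoid c₁ c₂ (range a)) _ ⟩
    avoid c₁ c₂ [ S₁ i ] + avoid c₁ c₂ [ S₂ i ] + avoid c₁ c₂ (range a)
      ≡⟨ cong₂ _+_ (cong₂ _+_ (row i) (col i)) avoid-α ⟩
    r i + s i + α
      ≡⟨ ⟨⟩-η (λ j → r j + s j + α) i ⟩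
    _ ∎
    where open ≡-Reasoning

  a<m : a < m
  a<m = <-trans (n<1+n a) (n<1+n b)

  S₁-between : ∀ i → a < S₁ i × S₁ i ≤ m
  S₁-between 0F = n<1+n a , n≤1+n b
  S₁-between 1F = n<1+n a , n≤1+n b
  S₁-between 2F = a<m , ≤-refl
  S₁-between 3F = a<m , ≤-refl

  S₂-above : ∀ i → m < S₂ i
  S₂-above 0F = m<m+n m (s≤s z≤n)
  S₂-above 1F = m<m+n m (s≤s z≤n)
  S₂-above 2F = m<m+n m (s≤s z≤n)
  S₂-above 3F = m<m+n m (s≤s z≤n)

  S₁≢ : ∀ {c₂} → c₂ ≤ a ⊎ m < c₂ → ∀ i → S₁ i ≢ c₂
  S₁≢ (inj₁ c₂≤a) i = >⇒≢ (≤-<-trans c₂≤a (proj₁ (S₁-between i)))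
  S₁≢ (inj₂ m<c₂) i = <⇒≢ (≤-<-trans (proj₂ (S₁-between i)) m<c₂)

  S₂≢ : ∀ {c₁} → c₁ ≤ m → ∀ i → S₂ i ≢ c₁
  S₂≢ c₁≤m i = >⇒≢ (≤-<-trans c₁≤m (S₂-above i))

  row-low : ∀ {c₁ c₂} → c₁ ≤ a → c₂ ≤ a ⊎ m < c₂ → ∀ i → avoid c₁ c₂ [ S₁ i ] ≡ 1
  row-low c₁≤a c₂∈ i = avoid-[]-miss (>⇒≢ (≤-<-trans c₁≤a (proj₁ (S₁-between i)))) (S₁≢ c₂∈ i)

  row-b : ∀ {c₂} → c₂ ≤ a ⊎ m < c₂ → ∀ i → avoid b c₂ [ S₁ i ] ≡ ⟨ 0 , 0 , 1 , 1 ⟩ i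
  row-b {c₂} _   0F = avoid-[]-hit {b} {c₂} {b} (inj₁ refl)
  row-b {c₂} _   1F = avoid-[]-hit {b} {c₂} {b} (inj₁ refl)
  row-b      c₂∈ 2F = avoid-[]-miss (>⇒≢ (n<1+n b)) (S₁≢ c₂∈ 2F)
  row-b      c₂∈ 3F = avoid-[]-miss (>⇒≢ (n<1+n b)) (S₁≢ c₂∈ 3F)

  row-m : ∀ {c₂} → c₂ ≤ a ⊎ m < c₂ → ∀ i → avoid m c₂ [ S₁ i ] ≡ ⟨ 1 , 1 , 0 , 0 ⟩ i
  row-m      c₂∈ 0F = avoid-[]-miss (<⇒≢ (n<1+n b)) (S₁≢ c₂∈ 0F)
  row-m      c₂∈ 1F = avoid-[]-miss (<⇒≢ (n<1+n b)) (S₁≢ c₂∈ 1F)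
  row-m {c₂} _   2F = avoid-[]-hit {m} {c₂} {m} (inj₁ refl)
  row-m {c₂} _   3F = avoid-[]-hit {m} {c₂} {m} (inj₁ refl)

  col-low : ∀ {c₁ c₂} → c₁ ≤ m → c₂ ≤ a → ∀ i → avoid c₁ c₂ [ S₂ i ] ≡ 1
  col-low c₁≤m c₂≤a i =
    avoid-[]-miss (S₂≢ c₁≤m i) (>⇒≢ (≤-<-trans c₂≤a (<-trans a<m (S₂-above i))))

  q₁<q₂ : q₁ < q₂
  q₁<q₂ = +-monoʳ-< m (n<1+n 1)

  col-q₁ : ∀ {c₁} → c₁ ≤ m → ∀ i → avoid c₁ q₁ [ S₂ i ] ≡ ⟨ 0 , 1 , 0 , 1 ⟩ i
  col-q₁ {c₁} _    0F = avoid-[]-hit {c₁} {q₁} {q₁} (inj₂ refl)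
  col-q₁      c₁≤m 1F = avoid-[]-miss (S₂≢ c₁≤m 1F) (>⇒≢ q₁<q₂)
  col-q₁ {c₁} _    2F = avoid-[]-hit {c₁} {q₁} {q₁} (inj₂ refl)
  col-q₁      c₁≤m 3F = avoid-[]-miss (S₂≢ c₁≤m 3F) (>⇒≢ q₁<q₂)

  col-q₂ : ∀ {c₁} → c₁ ≤ m → ∀ i → avoid c₁ q₂ [ S₂ i ] ≡ ⟨ 1 , 0 , 1 , 0 ⟩ i
  col-q₂      c₁≤m 0F = avoid-[]-miss (S₂≢ c₁≤m 0F) (<⇒≢ q₁<q₂)
  col-q₂ {c₁} _    1F = avoid-[]-hit {c₁} {q₂} {q₂} (inj₂ refl)
  col-q₂      c₁≤m 2F = avoid-[]-miss (S₂≢ c₁≤m 2F) (<⇒≢ q₁<q₂)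
  col-q₂ {c₁} _    3F = avoid-[]-hit {c₁} {q₂} {q₂} (inj₂ refl)

  module _ {c : ℕ} (0<c : 0 < c) (c≤a : c ≤ a) where

    private
      c≤m : c ≤ m
      c≤m = ≤-trans c≤a (<⇒≤ a<m)
      avoid-low-high : ∀ {c₂} → m < c₂ → avoid c c₂ (range a) ≡ k
      avoid-low-high m<c₂ = suc-injective (avoid-range-one a 0<c c≤a (inj₂ (<-trans a<m m<c₂)))
      avoid-high-low : ∀ {c₁} → a < c₁ → avoid c₁ c (range a) ≡ k
      avoid-high-low {c₁} a<c₁ =
        trans (avoid-sym {c₁} {c} (range a)) (suc-injective (avoid-range-one a 0<c c≤a (inj₂ a<c₁)))

    profile-diag : ∀ i → profile c c i ≡ ⟨ b , b , b , b ⟩ i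
    profile-diag = profile-≗ (row-low c≤a (inj₁ c≤a)) (col-low c≤m c≤a)
                             (suc-injective (avoid-range-one a 0<c c≤a (inj₁ refl)))

    profile-off : ∀ {c′} → 0 < c′ → c′ ≤ a → c ≢ c′ →
                  ∀ i → profile c c′ i ≡ ⟨ a , a , a , a ⟩ i
    profile-off 0<c′ c′≤a c≢c′ i =
      trans (profile-≗ (row-low c≤a (inj₁ c′≤a)) (col-low c≤m c′≤a) refl i)
            (cong (λ z → ⟨ z , z , z , z ⟩ i) (avoid-range-two a 0<c c≤a 0<c′ c′≤a c≢c′))

    profile-low-q₁ : ∀ i → profile c q₁ i ≡ ⟨ a , b , a , b ⟩ i
    profile-low-q₁ = profile-≗ (row-low c≤a (inj₂ (S₂-above 0F))) (col-q₁ c≤m) (avoid-low-high (S₂-above 0F))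

    profile-low-q₂ : ∀ i → profile c q₂ i ≡ ⟨ b , a , b , a ⟩ i
    profile-low-q₂ = profile-≗ (row-low c≤a (inj₂ (S₂-above 1F))) (col-q₂ c≤m) (avoid-low-high (S₂-above 1F))

    profile-b-low : ∀ i → profile b c i ≡ ⟨ a , a , b , b ⟩ i
    profile-b-low = profile-≗ (row-b (inj₁ c≤a)) (col-low (n≤1+n b) c≤a) (avoid-high-low (n<1+n a))

    profile-m-low : ∀ i → profile m c i ≡ ⟨ b , b , a , a ⟩ i
    profile-m-low = profile-≗ (row-m (inj₁ c≤a)) (col-low ≤-refl c≤a) (avoid-high-low a<m)

  avoid-high-high : ∀ {s} → a < s → ∀ j → avoid s (S₂ j) (range a) ≡ a
  avoid-high-high a<s j = avoid-range-none a a<s (<-trans a<m (S₂-above j))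

  profile-b-q₁ : ∀ i → profile b q₁ i ≡ ⟨ a , b , b , m ⟩ i
  profile-b-q₁ = profile-≗ (row-b (inj₂ (S₂-above 0F))) (col-q₁ (n≤1+n b)) (avoid-high-high (n<1+n a) 0F)

  profile-b-q₂ : ∀ i → profile b q₂ i ≡ ⟨ b , a , m , b ⟩ i
  profile-b-q₂ = profile-≗ (row-b (inj₂ (S₂-above 1F))) (col-q₂ (n≤1+n b)) (avoid-high-high (n<1+n a) 1F)

  profile-m-q₁ : ∀ i → profile m q₁ i ≡ ⟨ b , m , a , b ⟩ i
  profile-m-q₁ = profile-≗ (row-m (inj₂ (S₂-above 0F))) (col-q₁ ≤-refl) (avoid-high-high a<m 0F)

  profile-m-q₂ : ∀ i → profile m q₂ i ≡ ⟨ m , b , b , a ⟩ i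
  profile-m-q₂ = profile-≗ (row-m (inj₂ (S₂-above 1F))) (col-q₂ ≤-refl) (avoid-high-high a<m 1F)

  L₁ L₂ : List ℕ
  L₁ = range a ++ b ∷ m ∷ []
  L₂ = range a ++ q₁ ∷ q₂ ∷ []

  Σ² : (ℕ → ℕ → ℕ) → ℕ
  Σ² W = sum (map (λ c₁ → sum (map (W c₁) L₂)) L₁)

  Σ²-cong : ∀ {V W : ℕ → ℕ → ℕ} → (∀ c₁ c₂ → V c₁ c₂ ≡ W c₁ c₂) → Σ² V ≡ Σ² W
  Σ²-cong V≡W = cong sum (map-cong (λ c₁ → cong sum (map-cong (V≡W c₁) L₂)) L₁)

  -- The product over the y's of G_n, as a function of the profile: t vertices of
  -- each type, then the n ≤ 3 extra vertices.
  weight : ℕ → (Fin 4 → ℕ) → ℕ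
  weight n g = ∏ (λ i → g i ^ t) * (∏[ e < n ] g (extraType e))

  weight-cong : ∀ n {g h : Fin 4 → ℕ} → (∀ i → g i ≡ h i) → weight n g ≡ weight n h
  weight-cong n g≗h = cong₂ _*_ (∏-cong (cong (_^ t) ∘ g≗h)) (∏<-cong n (λ e _ → g≗h (extraType e)))

  y-product : ∀ c₁ c₂ →
    ∏[ j < 4 * t ] avoid c₁ c₂ (L0fun m t σ (2 + j)) ≡ ∏ (λ i → profile c₁ c₂ i ^ t)
  y-product c₁ c₂ =
    trans (∏<-blocks 4 t (λ i → avoid c₁ c₂ (range a ++ Aenum m σ (toFin4 i))))
          (sym (∏-permute (λ i → profile c₁ c₂ i ^ t) σ))

  P-L0 : P (K2 (4 * t)) (L0 m t σ) ≡ Σ² (λ c₁ c₂ → weight 0 (profile c₁ c₂))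
  P-L0 = trans (P-K2 (4 * t) (L0fun m t σ))
               (Σ²-cong (λ c₁ c₂ → trans (y-product c₁ c₂) (sym (*-identityʳ _))))

  P-Lc : ∀ n → P (K2 (4 * t + n)) (Lc m t σ n) ≡ Σ² (λ c₁ c₂ → weight n (profile c₁ c₂))
  P-Lc n = trans (P-K2 (4 * t + n) (L3fun m t σ)) (Σ²-cong λ c₁ c₂ →
    trans (∏<-+ (4 * t) n (λ j → avoid c₁ c₂ (L3fun m t σ (2 + j))))
          (cong₂ _*_
            (trans (∏<-cong (4 * t) (λ j j<4t → cong (avoid c₁ c₂) (L3fun-below m t σ j j<4t)))
                   (y-product c₁ c₂))
            (∏<-cong n (λ e _ → cong (avoid c₁ c₂) (L3fun-extra m t σ e)))))

  sum-weights : ∀ n → let w = weight n in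
    Σ² (λ c₁ c₂ → w (profile c₁ c₂))
      ≡ a * (w ⟨ b , b , b , b ⟩ + k * w ⟨ a , a , a , a ⟩
             + (w ⟨ a , b , a , b ⟩ + (w ⟨ b , a , b , a ⟩ + 0)))
        + ((a * w ⟨ a , a , b , b ⟩ + (w ⟨ a , b , b , m ⟩ + (w ⟨ b , a , m , b ⟩ + 0)))
        + ((a * w ⟨ b , b , a , a ⟩ + (w ⟨ b , m , a , b ⟩ + (w ⟨ m , b , b , a ⟩ + 0))) + 0))
  sum-weights n =
    trans (sum-++-pair across (range a) b m)
          (cong₂ _+_ (sum-range-const a across-low) (cong₂ _+_ across-b (cong (_+ 0) across-m)))
    where
    w : (Fin 4 → ℕ) → ℕ
    w = weight n
    w≗ : ∀ {g h} → (∀ i → g i ≡ h i) → w g ≡ w h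
    w≗ = weight-cong n
    across : ℕ → ℕ
    across c₁ = sum (map (λ c₂ → w (profile c₁ c₂)) L₂)
    across-low : ∀ c → 0 < c → c ≤ a →
      across c ≡ w ⟨ b , b , b , b ⟩ + k * w ⟨ a , a , a , a ⟩
                 + (w ⟨ a , b , a , b ⟩ + (w ⟨ b , a , b , a ⟩ + 0))
    across-low c 0<c c≤a =
      trans (sum-++-pair (λ c₂ → w (profile c c₂)) (range a) q₁ q₂)
            (cong₂ _+_ (sum-range-point k 0<c c≤a (w≗ (profile-diag 0<c c≤a)) λ c′ 0<c′ c′≤a c′≢c →
                          w≗ (profile-off 0<c c≤a 0<c′ c′≤a (≢-sym c′≢c)))
                       (cong₂ _+_ (w≗ (profile-low-q₁ 0<c c≤a)) (cong (_+ 0) (w≗ (profile-low-q₂ 0<c c≤a)))))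
    across-b : across b ≡ a * w ⟨ a , a , b , b ⟩ + (w ⟨ a , b , b , m ⟩ + (w ⟨ b , a , m , b ⟩ + 0))
    across-b = trans (sum-++-pair (λ c₂ → w (profile b c₂)) (range a) q₁ q₂)
                     (cong₂ _+_ (sum-range-const a (λ c 0<c c≤a → w≗ (profile-b-low 0<c c≤a)))
                                (cong₂ _+_ (w≗ profile-b-q₁) (cong (_+ 0) (w≗ profile-b-q₂))))
    across-m : across m ≡ a * w ⟨ b , b , a , a ⟩ + (w ⟨ b , m , a , b ⟩ + (w ⟨ m , b , b , a ⟩ + 0))
    across-m = trans (sum-++-pair (λ c₂ → w (profile m c₂)) (range a) q₁ q₂)
                     (cong₂ _+_ (sum-range-const a (λ c 0<c c≤a → w≗ (profile-m-low 0<c c≤a)))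
                                (cong₂ _+_ (w≗ profile-m-q₁) (cong (_+ 0) (w≗ profile-m-q₂))))

-- X, Y, Z stand for (m-2)^t, (m-1)^t, m^t, and w x₀ X₀ … x₃ X₃ for weight n at the profile
-- ⟨ x₀ , … , x₃ ⟩ with Xᵢ = xᵢ ^ t.  The ring solver does not recognise ℕ's _^_, so powers
-- with literal exponents are written out as the products they unfold to.

closed-form₀ : ∀ k X Y Z →
  let a = suc k ; b = suc a ; m = suc b
      X² = X * (X * 1) ; X⁴ = X * (X * X²) ; Y² = Y * (Y * 1) ; Y⁴ = Y * (Y * Y²) ; a¹ = a * 1
      w : ℕ → ℕ → ℕ → ℕ → ℕ → ℕ → ℕ → ℕ → ℕ
      w x₀ X₀ x₁ X₁ x₂ X₂ x₃ X₃ = X₀ * (X₁ * (X₂ * (X₃ * 1))) * 1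
  in a * (w b Y b Y b Y b Y + k * w a X a X a X a X + (w a X b Y a X b Y + (w b Y a X b Y a X + 0)))
     + ((a * w a X a X b Y b Y + (w a X b Y b Y m Z + (w b Y a X m Z b Y + 0)))
     + ((a * w b Y b Y a X a X + (w b Y m Z a X b Y + (w m Z b Y b Y a X + 0))) + 0))
   ≡ a * Y⁴ + k * (X⁴ * a¹) + 4 * (X² * a¹) * Y² + 4 * X * Y² * Z
closed-form₀ = solve-∀

closed-form₁ : ∀ k X Y Z →
  let a = suc k ; b = suc a ; m = suc b
      X² = X * (X * 1) ; X⁴ = X * (X * X²) ; Y² = Y * (Y * 1) ; Y⁴ = Y * (Y * Y²)
      a¹ = a * 1 ; a² = a * a¹ ; b¹ = b * 1
      w : ℕ → ℕ → ℕ → ℕ → ℕ → ℕ → ℕ → ℕ → ℕ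
      w x₀ X₀ x₁ X₁ x₂ X₂ x₃ X₃ = X₀ * (X₁ * (X₂ * (X₃ * 1))) * (x₀ * 1)
  in a * (w b Y b Y b Y b Y + k * w a X a X a X a X + (w a X b Y a X b Y + (w b Y a X b Y a X + 0)))
     + ((a * w a X a X b Y b Y + (w a X b Y b Y m Z + (w b Y a X m Z b Y + 0)))
     + ((a * w b Y b Y a X a X + (w b Y m Z a X b Y + (w m Z b Y b Y a X + 0))) + 0))
   ≡ a * (Y⁴ * b¹) + k * (X⁴ * a²) + 2 * (2 * k + 3) * (X² * a¹) * Y² + 4 * X * (Y² * b¹) * Z
closed-form₁ = solve-∀

closed-form₂ : ∀ k X Y Z →
  let a = suc k ; b = suc a ; m = suc b
      X² = X * (X * 1) ; X⁴ = X * (X * X²) ; Y² = Y * (Y * 1) ; Y⁴ = Y * (Y * Y²)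
      a¹ = a * 1 ; a² = a * a¹ ; a³ = a * a² ; b¹ = b * 1 ; b² = b * b¹
      w : ℕ → ℕ → ℕ → ℕ → ℕ → ℕ → ℕ → ℕ → ℕ
      w x₀ X₀ x₁ X₁ x₂ X₂ x₃ X₃ = X₀ * (X₁ * (X₂ * (X₃ * 1))) * (x₀ * (x₃ * 1))
  in a * (w b Y b Y b Y b Y + k * w a X a X a X a X + (w a X b Y a X b Y + (w b Y a X b Y a X + 0)))
     + ((a * w a X a X b Y b Y + (w a X b Y b Y m Z + (w b Y a X m Z b Y + 0)))
     + ((a * w b Y b Y a X a X + (w b Y m Z a X b Y + (w m Z b Y b Y a X + 0))) + 0))
   ≡ a * (Y⁴ * b²) + k * (X⁴ * a³) + 4 * (X² * a²) * (Y² * b¹)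
     + 2 * (2 * k * k + 8 * k + 6 + 1) * X * Y² * Z
closed-form₂ = solve-∀

closed-form₃ : ∀ k X Y Z →
  let a = suc k ; b = suc a ; m = suc b
      X² = X * (X * 1) ; X⁴ = X * (X * X²) ; Y² = Y * (Y * 1) ; Y⁴ = Y * (Y * Y²)
      a¹ = a * 1 ; a² = a * a¹ ; a³ = a * a² ; a⁴ = a * a³ ; b¹ = b * 1 ; b² = b * b¹ ; b³ = b * b²
      w : ℕ → ℕ → ℕ → ℕ → ℕ → ℕ → ℕ → ℕ → ℕ
      w x₀ X₀ x₁ X₁ x₂ X₂ x₃ X₃ = X₀ * (X₁ * (X₂ * (X₃ * 1))) * (x₀ * (x₃ * (x₁ * 1)))
  in a * (w b Y b Y b Y b Y + k * w a X a X a X a X + (w a X b Y a X b Y + (w b Y a X b Y a X + 0)))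
     + ((a * w a X a X b Y b Y + (w a X b Y b Y m Z + (w b Y a X m Z b Y + 0)))
     + ((a * w b Y b Y a X a X + (w b Y m Z a X b Y + (w m Z b Y b Y a X + 0))) + 0))
   ≡ a * (Y⁴ * b³) + k * (X⁴ * a⁴) + 2 * (2 * k + 3) * (X² * a²) * (Y² * b¹)
     + 2 * (2 * k * k + 8 * k + 6 + 1) * X * (Y² * b¹) * Z
closed-form₃ = solve-∀

^-* : ∀ x n t → x ^ (n * t) ≡ (x ^ t) ^ n
^-* x n t = trans (cong (x ^_) (*-comm n t)) (sym (^-*-assoc x t n))

^-*-+ : ∀ x n t j → x ^ (n * t + j) ≡ (x ^ t) ^ n * x ^ j
^-*-+ x n t j = trans (^-distribˡ-+-* x (n * t) j) (cong (_* x ^ j) (^-* x n t))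

2[3+k]∸3≡2k+3 : ∀ k → 2 * suc (suc (suc k)) ∸ 3 ≡ 2 * k + 3
2[3+k]∸3≡2k+3 k = trans (cong (_∸ 3) (expand k)) (m+n∸m≡n 3 (2 * k + 3))
  where
  expand : ∀ k → 2 * suc (suc (suc k)) ≡ 3 + (2 * k + 3)
  expand = solve-∀

2[3+k]²∸4[3+k]≡2k²+8k+6 : ∀ k → let m = suc (suc (suc k)) in 2 * m * m ∸ 4 * m ≡ 2 * k * k + 8 * k + 6
2[3+k]²∸4[3+k]≡2k²+8k+6 k =
  trans (cong (_∸ 4 * suc (suc (suc k))) (expand k))
        (m+n∸m≡n (4 * suc (suc (suc k))) (2 * k * k + 8 * k + 6))
  where
  expand : ∀ k → 2 * suc (suc (suc k)) * suc (suc (suc k))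
                 ≡ 4 * suc (suc (suc k)) + (2 * k * k + 8 * k + 6)
  expand = solve-∀

lemma11 : (t m : ℕ) → 3 ≤ m → (σ : Permutation′ 4) →
    (P (K2 (4 * t)) (L0 m t σ)
       ≡ (m ∸ 2) * (m ∸ 1) ^ (4 * t) + (m ∸ 3) * (m ∸ 2) ^ (4 * t + 1)
         + 4 * (m ∸ 2) ^ (2 * t + 1) * (m ∸ 1) ^ (2 * t)
         + 4 * (m ∸ 2) ^ t * (m ∸ 1) ^ (2 * t) * m ^ t)
  × (P (K2 (4 * t + 1)) (Lc m t σ 1)
       ≡ (m ∸ 2) * (m ∸ 1) ^ (4 * t + 1) + (m ∸ 3) * (m ∸ 2) ^ (4 * t + 2)
         + 2 * (2 * m ∸ 3) * (m ∸ 2) ^ (2 * t + 1) * (m ∸ 1) ^ (2 * t)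
         + 4 * (m ∸ 2) ^ t * (m ∸ 1) ^ (2 * t + 1) * m ^ t)
  × (P (K2 (4 * t + 2)) (Lc m t σ 2)
       ≡ (m ∸ 2) * (m ∸ 1) ^ (4 * t + 2) + (m ∸ 3) * (m ∸ 2) ^ (4 * t + 3)
         + 4 * (m ∸ 2) ^ (2 * t + 2) * (m ∸ 1) ^ (2 * t + 1)
         + 2 * (2 * m * m ∸ 4 * m + 1) * (m ∸ 2) ^ t * (m ∸ 1) ^ (2 * t) * m ^ t)
  × (P (K2 (4 * t + 3)) (Lc m t σ 3)
       ≡ (m ∸ 2) * (m ∸ 1) ^ (4 * t + 3) + (m ∸ 3) * (m ∸ 2) ^ (4 * t + 4)
         + 2 * (2 * m ∸ 3) * (m ∸ 2) ^ (2 * t + 2) * (m ∸ 1) ^ (2 * t + 1)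
         + 2 * (2 * m * m ∸ 4 * m + 1) * (m ∸ 2) ^ t * (m ∸ 1) ^ (2 * t + 1) * m ^ t)
-- The rewrite with 2[3+k]²∸4[3+k]≡2k²+8k+6 has to come before the one with 2[3+k]∸3≡2k+3,
-- which would otherwise fire inside the normal form of 2 * m * m ∸ 4 * m.
lemma11 t (suc (suc (suc k))) (s≤s (s≤s (s≤s z≤n))) σ
  rewrite ^-* (suc (suc k)) 4 t | ^-* (suc (suc k)) 2 t
        | ^-*-+ (suc (suc k)) 4 t 1 | ^-*-+ (suc (suc k)) 4 t 2 | ^-*-+ (suc (suc k)) 4 t 3
        | ^-*-+ (suc (suc k)) 2 t 1
        | ^-*-+ (suc k) 4 t 1 | ^-*-+ (suc k) 4 t 2 | ^-*-+ (suc k) 4 t 3 | ^-*-+ (suc k) 4 t 4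
        | ^-*-+ (suc k) 2 t 1 | ^-*-+ (suc k) 2 t 2
        | 2[3+k]²∸4[3+k]≡2k²+8k+6 k | 2[3+k]∸3≡2k+3 k
  = trans P-L0     (trans (sum-weights 0) (closed-form₀ k X Y Z))
  , trans (P-Lc 1) (trans (sum-weights 1) (closed-form₁ k X Y Z))
  , trans (P-Lc 2) (trans (sum-weights 2) (closed-form₂ k X Y Z))
  , trans (P-Lc 3) (trans (sum-weights 3) (closed-form₃ k X Y Z))
  where
  open Colourings k t σ
  X Y Z : ℕ
  X = a ^ t
  Y = b ^ t
  Z = m ^ t
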